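{- Let $(G,\Gamma,k)$ be a yes-instance of \textsc{Dilation $2$-Augmentation}, let $S$ be a minimal solution, and let $V_S$ be the set of end-points of the edges of $S$. Let $\mathbb{C}$ be the conflict graph. Then for every edge $(u,v)\in E(\mathbb{C})$, $|\{u,v\}\cap V_S|\ge 1$.
   Context: Let $\Gamma$ be a finite undirected unweighted graph with vertex set $V$, and let $d_\Gamma(u,v)$ denote the shortest-path (hop) distance in $\Gamma$. A graph $G$ on the same vertex set $V$ is viewed as edge-weighted: each edge $(u,v)$ of $G$ has weight $d_\Gamma(u,v)$, and $d_G(u,v)$ denotes the weighted shortest-path distance in $G$. For a set $S$ of non-edges of $G$, $G+S=(V,E(G)\cup S)$ with the same weighting rule. \textsc{Dilation $t$-Augmentation}: given $(G,\Gamma,k)$, decide whether there is a set $S$ of at most $k$ non-edges of $G$ (a solution) such that $d_{G+S}(u,v)\le t\cdot d_\Gamma(u,v)$ for all $u,v\in V$; a minimal solution is an inclusion-minimal such set. Two vertices $u,v$ are in adjacent conflict in $G$ (for $t=2$) if $(u,v)\in E(\Gamma)$ and $d_G(u,v)>2\cdot d_\Gamma(u,v)$. The conflict graph $\mathbb{C}$ is the graph on vertex set $V$ in which $u$ and $v$ are adjacent if and only if $u$ and $v$ are in adjacent conflict in $G$. -}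

module Defs where

open import Data.Nat using (ℕ; zero; suc; _+_; _*_; _≤_; _<_; _<ᵇ_)
open import Data.Fin using (Fin; toℕ)
open import Data.Bool using (Bool; true; false; _∨_; _∧_; T)
open import Data.Bool.Properties using (T?)
open import Data.List using (List; length; filter; concatMap; map)
open import Data.List using (allFin)
open import Data.Product using (Σ; ∃; _×_; _,_)
open import Data.Sum using (_⊎_)
open import Relation.Nullary using (¬_)
open import Relation.Binary.PropositionalEquality using (_≡_)

record Graph (n : ℕ) : Set where
  field
    adj    : Fin n → Fin n → Bool
    sym    : ∀ u v → adj u v ≡ adj v u
    irrefl : ∀ u → adj u u ≡ false
open Graph public

data HopWalk {n : ℕ} (Γ : Graph n) : Fin n → Fin n → ℕ → Set where
  here : ∀ {u} → HopWalk Γ u u 0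
  step : ∀ {u w v ℓ} → T (adj Γ u w) → HopWalk Γ w v ℓ → HopWalk Γ u v (suc ℓ)

HopDist : ∀ {n} → Graph n → Fin n → Fin n → ℕ → Set
HopDist Γ u v m = HopWalk Γ u v m × (∀ ℓ → ℓ < m → ¬ HopWalk Γ u v ℓ)

-- Walks in an edge set H (given by its adjacency), with total weight w,
-- where every edge (a,b) is weighted by d_Γ(a,b).  An edge whose endpoints
-- are Γ-disconnected has infinite weight and can never occur in a walk of
-- finite weight.
data WWalk {n : ℕ} (Γ : Graph n) (H : Fin n → Fin n → Bool)
     : Fin n → Fin n → ℕ → Set where
  here : ∀ {u} → WWalk Γ H u u 0
  step : ∀ {u x v d w} → T (H u x) → HopDist Γ u x d →
         WWalk Γ H x v w → WWalk Γ H u v (d + w)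

DistLe : ∀ {n} → Graph n → (Fin n → Fin n → Bool) → Fin n → Fin n → ℕ → Set
DistLe Γ H u v b = ∃ λ w → WWalk Γ H u v w × w ≤ b

_⊕_ : ∀ {n} → Graph n → Graph n → (Fin n → Fin n → Bool)
(G ⊕ S) a b = adj G a b ∨ adj S a b

edgeCount : ∀ {n} → Graph n → ℕ
edgeCount {n} H =
  length (filter (λ p → T? (edgeP p))
                 (concatMap (λ i → map (λ j → (i , j)) (allFin n)) (allFin n)))
  where
  edgeP : Fin n × Fin n → Bool
  edgeP (i , j) = adj H i j ∧ (toℕ i <ᵇ toℕ j)

NonEdgesOf : ∀ {n} → Graph n → Graph n → Set
NonEdgesOf G S = ∀ u v → T (adj S u v) → adj G u v ≡ false

-- H+S is a 2-spanner of Γ: d_{G+S}(u,v) ≤ 2·d_Γ(u,v) for all u, v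
-- (vacuous when d_Γ(u,v) = ∞).
Dilation2 : ∀ {n} → Graph n → Graph n → Graph n → Set
Dilation2 Γ G S = ∀ u v m → HopDist Γ u v m → DistLe Γ (G ⊕ S) u v (2 * m)

IsSolution : ∀ {n} → Graph n → Graph n → ℕ → Graph n → Set
IsSolution G Γ k S = NonEdgesOf G S × edgeCount S ≤ k × Dilation2 Γ G S

_⊂_ : ∀ {n} → Graph n → Graph n → Set
S' ⊂ S = (∀ u v → T (adj S' u v) → T (adj S u v))
       × ∃ λ u → ∃ λ v → T (adj S u v) × ¬ T (adj S' u v)

IsMinimalSolution : ∀ {n} → Graph n → Graph n → ℕ → Graph n → Set
IsMinimalSolution G Γ k S =
  IsSolution G Γ k S × (∀ S' → S' ⊂ S → ¬ IsSolution G Γ k S')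

AdjConflict : ∀ {n} → Graph n → Graph n → Fin n → Fin n → Set
AdjConflict G Γ u v =
  T (adj Γ u v) × (∀ m → HopDist Γ u v m → ¬ DistLe Γ (adj G) u v (2 * m))

Endpoint : ∀ {n} → Graph n → Fin n → Set
Endpoint S u = ∃ λ w → T (adj S u w)

{-# OPTIONS --safe #-}
-- Since u and v are adjacent in Γ, the solution S gives a u–v walk in G + S
-- of weight at most 2.  Distinct endpoints put every edge at Γ-distance at
-- least 1, so this walk has at most two edges, and each of them is incident
-- to u or to v.  By the conflict the walk cannot lie in G, so one of its
-- edges is in S.
module Submission where

open import Defs
open import Data.Nat using (ℕ; zero; suc; _≤_; _<_; s≤s; z≤n)
open import Data.Nat.Properties using (≤-trans; +-mono-≤)
open import Data.Fin using (Fin)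
open import Data.Sum using (_⊎_; inj₁; inj₂)
open import Data.Bool using (Bool; T)
open import Data.Bool.Properties using (T-∨)
open import Data.Empty using (⊥-elim)
open import Data.Product using (_,_)
open import Function.Bundles using (Equivalence)
open import Relation.Nullary using (¬_)
open import Relation.Binary.PropositionalEquality using (subst)

module _ {n : ℕ} where

  Loopless : (Fin n → Fin n → Bool) → Set
  Loopless H = ∀ a → ¬ T (H a a)

  graph-loopless : (H : Graph n) → Loopless (adj H)
  graph-loopless H a rewrite irrefl H a = λ ()

  ⊕-loopless : (G S : Graph n) → Loopless (G ⊕ S)
  ⊕-loopless G S a rewrite irrefl G a | irrefl S a = λ ()

  ⊕-edge : (G S : Graph n) {a b : Fin n} →
           T ((G ⊕ S) a b) → T (adj G a b) ⊎ T (adj S a b)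
  ⊕-edge G S {a} {b} = Equivalence.to (T-∨ {adj G a b})

  adj-sym : (H : Graph n) {a b : Fin n} → T (adj H a b) → T (adj H b a)
  adj-sym H {a} {b} = subst T (sym H a b)

  hopDist-adjacent : (Γ : Graph n) {u v : Fin n} → T (adj Γ u v) → HopDist Γ u v 1
  hopDist-adjacent Γ {u} uv = step uv here , shorter
    where
    shorter : ∀ ℓ → ℓ < 1 → ¬ HopWalk Γ u _ ℓ
    shorter zero _ here = graph-loopless Γ u uv
    shorter (suc _) (s≤s ()) _

  module _ {Γ : Graph n} {H : Fin n → Fin n → Bool} where

    edge-weight-positive : Loopless H → ∀ {a b d} →
                           T (H a b) → HopDist Γ a b d → 1 ≤ d
    edge-weight-positive loopless {a} {d = zero} ab (here , _) = ⊥-elim (loopless a ab)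
    edge-weight-positive loopless {d = suc _} _ _ = s≤s z≤n

    hopCount : ∀ {u v w} → WWalk Γ H u v w → ℕ
    hopCount here = 0
    hopCount (step _ _ p) = suc (hopCount p)

    hopCount≤weight : Loopless H → ∀ {u v w} (p : WWalk Γ H u v w) →
                      hopCount p ≤ w
    hopCount≤weight loopless here = z≤n
    hopCount≤weight loopless (step ab hd p) =
      +-mono-≤ (edge-weight-positive loopless ab hd) (hopCount≤weight loopless p)

  hopCount≤2⇒in-G⊎meets-S : {Γ : Graph n} (G S : Graph n) {u v : Fin n} {w : ℕ} →
    (p : WWalk Γ (G ⊕ S) u v w) → hopCount p ≤ 2 →
    WWalk Γ (adj G) u v w ⊎ (Endpoint S u ⊎ Endpoint S v)
  hopCount≤2⇒in-G⊎meets-S G S here _ = inj₁ here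
  hopCount≤2⇒in-G⊎meets-S G S (step ux hd here) _ with ⊕-edge G S ux
  ... | inj₁ g = inj₁ (step g hd here)
  ... | inj₂ s = inj₂ (inj₁ (_ , s))
  hopCount≤2⇒in-G⊎meets-S G S (step ux hd (step xv hd′ here)) _
    with ⊕-edge G S ux | ⊕-edge G S xv
  ... | inj₂ s | _       = inj₂ (inj₁ (_ , s))
  ... | inj₁ _ | inj₂ s  = inj₂ (inj₂ (_ , adj-sym S s))
  ... | inj₁ g | inj₁ g′ = inj₁ (step g hd (step g′ hd′ here))
  hopCount≤2⇒in-G⊎meets-S G S (step _ _ (step _ _ (step _ _ _))) (s≤s (s≤s ()))

lemma3 : ∀ {n : ℕ} (G Γ : Graph n) (k : ℕ) (S : Graph n) →
    IsMinimalSolution G Γ k S →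
    ∀ (u v : Fin n) → AdjConflict G Γ u v →
    Endpoint S u ⊎ Endpoint S v
lemma3 G Γ k S ((_ , _ , dilation) , _) u v (uv , conflict)
  with dilation u v 1 (hopDist-adjacent Γ uv)
... | w , p , w≤2
  with hopCount≤2⇒in-G⊎meets-S G S p
         (≤-trans (hopCount≤weight (⊕-loopless G S) p) w≤2)
... | inj₁ pG = ⊥-elim (conflict 1 (hopDist-adjacent Γ uv) (w , pG , w≤2))
... | inj₂ meetsS = meetsS
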